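{- Let $m\in\mathbb{N}$ and $a\in\mathbb{Z}_m$. Then $a$ is regular modulo $m$ if and only if for all $k,l\in\mathbb{N}$: \[ a^k\equiv a^l\pmod m \iff k\equiv l\pmod{|a|_m}. \]
   Context: $\mathbb{N}=\{1,2,\dots\}$, $\mathbb{Z}_m=\{1,\dots,m\}$. $\mathrm{E}_m=\{e\in\mathbb{Z}_m: e^2\equiv e\pmod m\}$. For $a\in\mathbb{Z}$, the order $|a|_m$ is the smallest $n\in\mathbb{N}$ such that $a^n$ is congruent modulo $m$ to an element of $\mathrm{E}_m$. $a\in\mathbb{Z}_m$ is regular modulo $m$ if $a^{|a|_m+1}\equiv a\pmod m$. -}

module Defs where

open import Data.Nat using (ℕ; _^_; _≤_; _*_)
open import Data.Product using (_×_; ∃-syntax)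
open import Data.Integer as ℤ using (ℤ; +_; _-_)
open import Data.Integer.Divisibility using (_∣_)
open import Relation.Nullary using (¬_)
open import Data.Nat using (_<_)

infix 4 _≡_[mod_]
_≡_[mod_] : ℕ → ℕ → ℕ → Set
x ≡ y [mod m ] = (+ m) ∣ ((+ x) - (+ y))

InZ : ℕ → ℕ → Set
InZ m e = 1 ≤ e × e ≤ m

InE : ℕ → ℕ → Set
InE m e = InZ m e × (e * e ≡ e [mod m ])

PowIdem : ℕ → ℕ → ℕ → Set
PowIdem m a n = ∃[ e ] (InE m e × (a ^ n ≡ e [mod m ]))

IsOrder : ℕ → ℕ → ℕ → Set
IsOrder m a n = 1 ≤ n × PowIdem m a n × (∀ j → 1 ≤ j → j < n → ¬ PowIdem m a j)

-- a is regular modulo m, where n = |a|_m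
Regular : ℕ → ℕ → ℕ → Set
Regular m a n = a ^ (n Data.Nat.+ 1) ≡ a [mod m ]

module Submission where

-- The backward direction is the instance k = n + 1, l = 1.  For the forward
-- direction, regularity says that n is a period of the powers a^x (x ≥ 1), so
-- k ≡ l (mod n) gives a^k ≡ a^l.  Conversely, suppose a^(l+d) ≡ a^l and write
-- d = q·n + r with r < n.  Then r is also a period at l, and a period at a
-- single exponent l spreads, using the period n, to every exponent x ≥ 1.
-- Taking x = r gives a^r · a^r ≡ a^r: the residue a^r is idempotent, hence
-- congruent to an element of E_m, which the minimality of n forbids unless
-- r = 0.

open import Defs
open import Data.Nat using (ℕ; _^_; _≤_)
open import Function.Bundles using (_⇔_)

open import Data.Nat using (zero; suc; _+_; _*_; _<_; z≤n; s≤s; _%_; _/_; NonZero; >-nonZero⁻¹)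
open import Data.Nat.Properties using (+-identityʳ; +-comm; +-assoc; *-comm; *-identityʳ; ^-distribˡ-+-*; ≤-refl; <⇒≤; ≤-total; m≤n⇒∃[o]m+o≡n)
open import Data.Nat.Divisibility using (_∣_; divides; _∣0; ∣-refl)
open import Data.Nat.DivMod using (m≡m%n+[m/n]*n; m%n<n)
open import Data.Nat.Tactic.RingSolver using (solve)
open import Data.Integer as ℤ using (+_)
import Data.Integer.Properties as ℤ
import Data.Integer.Divisibility.Signed as Signed
import Data.Integer.Tactic.RingSolver as ℤ-Solver
open import Data.List using (_∷_; [])
open import Data.Product using (_×_; _,_; ∃-syntax)
open import Data.Sum using (inj₁; inj₂)
open import Data.Empty using (⊥-elim)
open import Function.Bundles using (mk⇔; Equivalence)
import Function.Properties.Equivalence as ⇔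
open import Relation.Binary.Bundles using (Setoid)
open import Level using (0ℓ)
import Relation.Binary.Reasoning.Setoid as SetoidReasoning
open import Relation.Binary.PropositionalEquality using (_≡_; refl; sym; trans; cong; cong₂; subst; subst₂)
open import Relation.Nullary using (¬_)

-- The relation of Defs unfolds to a
-- divisibility statement about an integer difference, from which Agda cannot
-- recover x and y; the record type constructor is injective, so all implicit
-- arguments below are inferred.
infix 4 _≈_⟨mod_⟩
record _≈_⟨mod_⟩ (x y m : ℕ) : Set where
  constructor wrap
  field unwrap : x ≡ y [mod m ]
open _≈_⟨mod_⟩

unwrap⇔ : ∀ {x y m x′ y′ m′} → (x ≈ y ⟨mod m ⟩) ⇔ (x′ ≈ y′ ⟨mod m′ ⟩) →
          (x ≡ y [mod m ]) ⇔ (x′ ≡ y′ [mod m′ ])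
unwrap⇔ e = mk⇔ (λ h → unwrap (Equivalence.to e (wrap h))) (λ h → unwrap (Equivalence.from e (wrap h)))

+≈⇔∣ : ∀ {m} y d → (y + d ≈ y ⟨mod m ⟩) ⇔ (m ∣ d)
+≈⇔∣ {m} y d = mk⇔ (λ h → subst (m ∣_) (cong ℤ.∣_∣ difference) (unwrap h))
                   (λ h → wrap (subst (m ∣_) (cong ℤ.∣_∣ (sym difference)) h))
  where
  cancel : ∀ i j → (i ℤ.+ j) ℤ.- i ≡ j
  cancel = ℤ-Solver.solve-∀
  difference : + (y + d) ℤ.- + y ≡ + d
  difference = trans (cong (ℤ._- + y) (ℤ.pos-+ y d)) (cancel (+ y) (+ d))

≈-refl : ∀ {m} x → x ≈ x ⟨mod m ⟩
≈-refl {m} x = subst (_≈ x ⟨mod m ⟩) (+-identityʳ x) (Equivalence.from (+≈⇔∣ x 0) (m ∣0))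

≈-sym : ∀ {m x y} → x ≈ y ⟨mod m ⟩ → y ≈ x ⟨mod m ⟩
≈-sym {m} {x} {y} (wrap h) = wrap (subst (m ∣_) (ℤ.∣i-j∣≡∣j-i∣ (+ x) (+ y)) h)

≈-trans : ∀ {m x y z} → x ≈ y ⟨mod m ⟩ → y ≈ z ⟨mod m ⟩ → x ≈ z ⟨mod m ⟩
≈-trans {m} {x} {y} {z} (wrap p) (wrap q) =
  wrap (Signed.∣⇒∣ᵤ (subst (+ m Signed.∣_) (telescope (+ x) (+ y) (+ z))
                           (Signed.∣m∣n⇒∣m+n {m = + x ℤ.- + y} (Signed.∣ᵤ⇒∣ p) (Signed.∣ᵤ⇒∣ q))))
  where
  telescope : ∀ i j k → (i ℤ.- j) ℤ.+ (j ℤ.- k) ≡ i ℤ.- k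
  telescope = ℤ-Solver.solve-∀

≈-setoid : ℕ → Setoid 0ℓ 0ℓ
≈-setoid m = record
  { Carrier       = ℕ
  ; _≈_           = _≈_⟨mod m ⟩
  ; isEquivalence = record { refl = ≈-refl _ ; sym = ≈-sym ; trans = ≈-trans }
  }

≈-sym⇔ : ∀ {m x y} → (x ≈ y ⟨mod m ⟩) ⇔ (y ≈ x ⟨mod m ⟩)
≈-sym⇔ = mk⇔ ≈-sym ≈-sym

*-congˡ : ∀ {m x y} c → x ≈ y ⟨mod m ⟩ → c * x ≈ c * y ⟨mod m ⟩
*-congˡ {m} {x} {y} c (wrap h) =
  wrap (Signed.∣⇒∣ᵤ (subst (+ m Signed.∣_) scaled (Signed.∣n⇒∣m*n (+ c) (Signed.∣ᵤ⇒∣ h))))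
  where
  distrib : ∀ i j k → i ℤ.* (j ℤ.- k) ≡ i ℤ.* j ℤ.- i ℤ.* k
  distrib = ℤ-Solver.solve-∀
  scaled : + c ℤ.* (+ x ℤ.- + y) ≡ + (c * x) ℤ.- + (c * y)
  scaled = trans (distrib (+ c) (+ x) (+ y)) (cong₂ ℤ._-_ (sym (ℤ.pos-* c x)) (sym (ℤ.pos-* c y)))

*-cong : ∀ {m x x′ y y′} → x ≈ x′ ⟨mod m ⟩ → y ≈ y′ ⟨mod m ⟩ → x * y ≈ x′ * y′ ⟨mod m ⟩
*-cong {m} {x} {x′} {y} {y′} p q = begin
  x * y    ≈⟨ *-congˡ x q ⟩
  x * y′   ≡⟨ *-comm x y′ ⟩
  y′ * x   ≈⟨ *-congˡ y′ p ⟩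
  y′ * x′  ≡⟨ *-comm y′ x′ ⟩
  x′ * y′  ∎
  where open SetoidReasoning (≈-setoid m)

-- Every natural number is congruent modulo m ≥ 1 to an element of Z_m = {1, …, m}:
-- its remainder, or m itself when the remainder is 0.
representative : ∀ m .{{_ : NonZero m}} x → ∃[ e ] (InZ m e × x ≈ e ⟨mod m ⟩)
representative m x = choose (x % m) (m%n<n x m) x≈x%m
  where
  x≈x%m : x ≈ x % m ⟨mod m ⟩
  x≈x%m = subst (_≈ x % m ⟨mod m ⟩) (sym (m≡m%n+[m/n]*n x m))
                (Equivalence.from (+≈⇔∣ (x % m) (x / m * m)) (divides (x / m) refl))
  choose : ∀ r → r < m → x ≈ r ⟨mod m ⟩ → ∃[ e ] (InZ m e × x ≈ e ⟨mod m ⟩)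
  choose zero    _   x≈0 = m , (>-nonZero⁻¹ m , ≤-refl) , ≈-trans x≈0 (≈-sym (Equivalence.from (+≈⇔∣ 0 m) ∣-refl))
  choose (suc r) r<m x≈r = suc r , (s≤s z≤n , <⇒≤ r<m) , x≈r

idempotent⇒∈E : ∀ m .{{_ : NonZero m}} x → x * x ≈ x ⟨mod m ⟩ → ∃[ e ] (InE m e × x ≡ e [mod m ])
idempotent⇒∈E m x idem with representative m x
... | e , e∈Z , x≈e = e , (e∈Z , unwrap e-idem) , unwrap x≈e
  where
  open SetoidReasoning (≈-setoid m)
  e-idem : e * e ≈ e ⟨mod m ⟩
  e-idem = begin
    e * e  ≈⟨ *-cong (≈-sym x≈e) (≈-sym x≈e) ⟩
    x * x  ≈⟨ idem ⟩
    x      ≈⟨ x≈e ⟩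
    e      ∎

module Powers (m a : ℕ) where
  open SetoidReasoning (≈-setoid m)

  shift : ∀ {k l} t → a ^ k ≈ a ^ l ⟨mod m ⟩ → a ^ (t + k) ≈ a ^ (t + l) ⟨mod m ⟩
  shift {k} {l} t h = begin
    a ^ (t + k)    ≡⟨ ^-distribˡ-+-* a t k ⟩
    a ^ t * a ^ k  ≈⟨ *-congˡ (a ^ t) h ⟩
    a ^ t * a ^ l  ≡⟨ sym (^-distribˡ-+-* a t l) ⟩
    a ^ (t + l)    ∎

  periodic : ∀ {l p} → a ^ (l + p) ≈ a ^ l ⟨mod m ⟩ → ∀ t q → a ^ (l + t + q * p) ≈ a ^ (l + t) ⟨mod m ⟩
  periodic {l} h t zero = subst (λ e → a ^ e ≈ a ^ (l + t) ⟨mod m ⟩) (sym (+-identityʳ (l + t))) (≈-refl _)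
  periodic {l} {p} h t (suc q) = begin
    a ^ (l + t + (p + q * p))  ≡⟨ cong (a ^_) regroup ⟩
    a ^ (t + q * p + (l + p))  ≈⟨ shift {l + p} {l} (t + q * p) h ⟩
    a ^ (t + q * p + l)        ≡⟨ cong (a ^_) reorder ⟩
    a ^ (l + t + q * p)        ≈⟨ periodic {l} {p} h t q ⟩
    a ^ (l + t)                ∎
    where
    regroup : l + t + (p + q * p) ≡ t + q * p + (l + p)
    regroup = solve (l ∷ t ∷ p ∷ q ∷ [])
    reorder : t + q * p + l ≡ l + t + q * p
    reorder = solve (l ∷ t ∷ p ∷ q ∷ [])

  module RegularPowers (n′ : ℕ) (regular : Regular m a (suc n′)) where
    n : ℕ
    n = suc n′

    absorb : ∀ x q → a ^ (suc x + q * n) ≈ a ^ suc x ⟨mod m ⟩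
    absorb = periodic {1} {n} (wrap (subst₂ (λ u v → u ≡ v [mod m ]) (cong (a ^_) (+-comm n 1)) (sym (*-identityʳ a)) regular))

    -- A period r at a single exponent l ≥ 1 is a period at every exponent x ≥ 1:
    -- a^(x+r) ≡ a^(x + r + (l+1)n), which lies beyond l, where r may be dropped.
    spread : ∀ l r → a ^ (suc l + r) ≈ a ^ suc l ⟨mod m ⟩ → ∀ x → a ^ (suc x + r) ≈ a ^ suc x ⟨mod m ⟩
    spread l r h x = begin
      a ^ (suc x + r)                     ≈⟨ ≈-sym (absorb (x + r) (suc l)) ⟩
      a ^ (suc x + r + suc l * n)         ≡⟨ cong (a ^_) regroup ⟩
      a ^ (beyond + (suc l + r))          ≈⟨ shift {suc l + r} {suc l} beyond h ⟩
      a ^ (beyond + suc l)                ≡⟨ cong (a ^_) reorder ⟩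
      a ^ (suc x + suc l * n)             ≈⟨ absorb x (suc l) ⟩
      a ^ suc x                           ∎
      where
      beyond : ℕ
      beyond = suc x + suc l * n′
      regroup : suc x + r + suc l * suc n′ ≡ suc x + suc l * n′ + (suc l + r)
      regroup = solve (x ∷ r ∷ l ∷ n′ ∷ [])
      reorder : suc x + suc l * n′ + suc l ≡ suc x + suc l * suc n′
      reorder = solve (x ∷ l ∷ n′ ∷ [])

    period-iff-divides : (∀ r → 1 ≤ r → r < n → ¬ (a ^ r * a ^ r ≈ a ^ r ⟨mod m ⟩)) →
                         ∀ l d → (a ^ (suc l + d) ≈ a ^ suc l ⟨mod m ⟩) ⇔ (n ∣ d)
    period-iff-divides no-idempotent l d = mk⇔ divides-period (λ { (divides q refl) → absorb l q })
      where
      divides-period : a ^ (suc l + d) ≈ a ^ suc l ⟨mod m ⟩ → n ∣ d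
      divides-period h = remainder-vanishes (d % n) (d / n) (m≡m%n+[m/n]*n d n) (m%n<n d n)
        where
        -- Write d = r + q · n; a nonzero remainder r would be an idempotent exponent.
        remainder-vanishes : ∀ r q → d ≡ r + q * n → r < n → n ∣ d
        remainder-vanishes zero     q d≡qn _   = divides q d≡qn
        remainder-vanishes (suc r′) q d≡rqn r<n =
          ⊥-elim (no-idempotent r (s≤s z≤n) r<n r-idempotent)
          where
          r = suc r′
          r-period : a ^ (suc l + r) ≈ a ^ suc l ⟨mod m ⟩
          r-period = begin
            a ^ (suc l + r)              ≈⟨ ≈-sym (absorb (l + r) q) ⟩
            a ^ (suc l + r + q * n)      ≡⟨ cong (a ^_) (trans (+-assoc (suc l) r (q * n)) (cong (λ e → suc l + e) (sym d≡rqn))) ⟩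
            a ^ (suc l + d)              ≈⟨ h ⟩
            a ^ suc l                    ∎
          r-idempotent : a ^ r * a ^ r ≈ a ^ r ⟨mod m ⟩
          r-idempotent = begin
            a ^ r * a ^ r  ≡⟨ sym (^-distribˡ-+-* a r r) ⟩
            a ^ (r + r)    ≈⟨ spread l r r-period r′ ⟩
            a ^ r          ∎

by-difference : {P : ℕ → ℕ → Set} → (∀ {k l} → P k l → P l k) → (∀ l d → P (l + d) l) → ∀ k l → P k l
by-difference swap base k l with ≤-total l k
... | inj₁ l≤k with d , refl ← m≤n⇒∃[o]m+o≡n l≤k = base l d
... | inj₂ k≤l with d , refl ← m≤n⇒∃[o]m+o≡n k≤l = swap (base k d)

proposition2p6 : (m a : ℕ) → 1 ≤ m → 1 ≤ a → a ≤ m → (n : ℕ) → IsOrder m a n →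
    Regular m a n ⇔ (∀ (k l : ℕ) → 1 ≤ k → 1 ≤ l → ((a ^ k ≡ a ^ l [mod m ]) ⇔ (k ≡ l [mod n ])))
proposition2p6 m@(suc _) a _ _ _ n@(suc n′) (_ , _ , minimal) = mk⇔ characterisation recover
  where
  open Powers m a

  no-idempotent : ∀ r → 1 ≤ r → r < n → ¬ (a ^ r * a ^ r ≈ a ^ r ⟨mod m ⟩)
  no-idempotent r 1≤r r<n idem = minimal r 1≤r r<n (idempotent⇒∈E m (a ^ r) idem)

  PowerLaw : ℕ → ℕ → Set
  PowerLaw k l = 1 ≤ k → 1 ≤ l → (a ^ k ≈ a ^ l ⟨mod m ⟩) ⇔ (k ≈ l ⟨mod n ⟩)

  characterisation : Regular m a n → ∀ k l → 1 ≤ k → 1 ≤ l → (a ^ k ≡ a ^ l [mod m ]) ⇔ (k ≡ l [mod n ])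
  characterisation regular k l 1≤k 1≤l = unwrap⇔ (by-difference swap base k l 1≤k 1≤l)
    where
    open RegularPowers n′ regular using (period-iff-divides)
    swap : ∀ {k l} → PowerLaw k l → PowerLaw l k
    swap law 1≤l 1≤k = ⇔.trans ≈-sym⇔ (⇔.trans (law 1≤k 1≤l) ≈-sym⇔)
    base : ∀ l d → PowerLaw (l + d) l
    base (suc l) d _ _ = ⇔.trans (period-iff-divides no-idempotent l d) (⇔.sym (+≈⇔∣ (suc l) d))

  recover : (∀ k l → 1 ≤ k → 1 ≤ l → (a ^ k ≡ a ^ l [mod m ]) ⇔ (k ≡ l [mod n ])) → Regular m a n
  recover law = subst (λ u → a ^ (n + 1) ≡ u [mod m ]) (*-identityʳ a)
                      (Equivalence.from (law (n + 1) 1 (s≤s z≤n) (s≤s z≤n)) n+1≡1)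
    where
    n+1≡1 : n + 1 ≡ 1 [mod n ]
    n+1≡1 = unwrap (subst (_≈ 1 ⟨mod n ⟩) (+-comm 1 n) (Equivalence.from (+≈⇔∣ 1 n) ∣-refl))
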